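{- Let $\mathcal{B}$ be a nonempty finite set of positive integers and $\lambda=(\lambda_1,\dots,\lambda_m)$ a composition of $|\mathcal{B}|$. Then $$|\mathrm{PSTab}_{\mathcal{B}}(\lambda)|=\frac{(|\mathcal{B}|-1)!}{\prod_{i=1}^{m-1}\Big(|\mathcal{B}|-\sum_{j=1}^{i}\lambda_j\Big)\cdot\prod_{k=1}^{m}(\lambda_k-1)!}.$$
   Context: A composition of $N$ is a sequence of positive integers summing to $N$. For $\lambda=(\lambda_1,\dots,\lambda_m)$, the composition diagram of shape $\lambda$ has $m$ bottom-justified columns, left to right, with $\lambda_i$ boxes in column $i$. $\mathrm{PSTab}_{\mathcal{B}}(\lambda)$ is the set of fillings of this diagram in which every element of $\mathcal{B}$ appears exactly once, every column is increasing from bottom to top, and the bottom row (lowest boxes) is increasing from left to right. Empty products equal $1$. -}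

module Defs where

open import Data.Nat using (ℕ; zero; suc; _+_; _*_; _∸_; _<_; _!)
open import Data.Nat.Properties using (_≟_)
open import Data.Nat.ListAction using (sum)
open import Data.List using (List; []; _∷_; map; length; concat; filter)
open import Data.List.Membership.Propositional using (_∈_)
open import Data.List.Relation.Unary.All using (All)
open import Data.List.Relation.Unary.Linked using (Linked)
open import Data.Empty using (⊥)
open import Data.Product using (_×_)
open import Relation.Binary.PropositionalEquality using (_≡_)

IsComposition : ℕ → List ℕ → Set
IsComposition N λs = All (0 <_) λs × sum λs ≡ N

-- A filling of a composition diagram: list of columns (left to right),
-- each column listed from bottom to top.
Filling : Set
Filling = List (List ℕ)

occurrences : ℕ → List ℕ → ℕ
occurrences b xs = length (filter (b ≟_) xs)

BottomLt : List ℕ → List ℕ → Set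
BottomLt (x ∷ _) (y ∷ _) = x < y
BottomLt _ _ = ⊥

IsPSTab : List ℕ → List ℕ → Filling → Set
IsPSTab B λs T =
  map length T ≡ λs
  × (∀ x → x ∈ concat T → x ∈ B)
  × (∀ b → b ∈ B → occurrences b (concat T) ≡ 1)
  × All (Linked _<_) T
  × Linked BottomLt T

-- prodPartial N (λ₁ ∷ … ∷ λₘ) = ∏_{i=1}^{m-1} (N - Σ_{j=1}^{i} λ_j)
prodPartial : ℕ → List ℕ → ℕ
prodPartial N [] = 1
prodPartial N (x ∷ []) = 1
prodPartial N (x ∷ y ∷ rest) = (N ∸ x) * prodPartial (N ∸ x) (y ∷ rest)

prodFact : List ℕ → ℕ
prodFact [] = 1
prodFact (x ∷ rest) = ((x ∸ 1) !) * prodFact rest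

-- Sort the letters increasingly. With increasing columns and an increasing bottom row, the least
-- letter x must sit in the bottom-left box, so a filling of shape (λ₁, …, λₘ) by N letters is x,
-- a choice of λ₁ - 1 of the other N - 1 letters completing the first column, and a filling of
-- (λ₂, …, λₘ) by the N - λ₁ letters left over. Enumerating fillings this way gives a list without
-- repetitions of length ∏ᵢ C(nᵢ - 1, λᵢ - 1), where nᵢ = N - Σ_{j<i} λⱼ, and since
-- C(nᵢ - 1, λᵢ - 1) (λᵢ - 1)! nᵢ₊₁ (nᵢ₊₁ - 1)! = (nᵢ - 1)! the product telescopes to the formula.
module Submission where

open import Defs
open import Data.Nat using (ℕ; zero; suc; _+_; _*_; _∸_; _<_; _≤_; _!)
open import Data.Nat.Properties
open import Data.Nat.Combinatorics using (_C_; nCn≡1; nCk≡n!/k![n-k]!; k![n∸k]!∣n!; nCk+nC[k+1]≡[n+1]C[k+1])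
open import Data.Nat.DivMod using (_/_; m/n*n≡m)
open import Data.Nat.Tactic.RingSolver using (solve-∀)
open import Data.Nat.ListAction using (sum)
open import Data.List using (List; []; _∷_; length; map; concat; concatMap; _++_; filter)
open import Data.List.Properties using (length-++; length-map; ∷-injectiveˡ; ∷-injectiveʳ; filter-accept; filter-reject; filter-none; filter-some)
open import Data.List.Membership.Propositional using (_∈_; _∉_)
open import Data.List.Membership.Propositional.Properties
open import Data.List.Relation.Unary.Any using (here; there)
open import Data.List.Relation.Unary.All as All using (All; []; _∷_)
open import Data.List.Relation.Unary.All.Properties as AllP using (¬Any⇒All¬)
open import Data.List.Relation.Unary.AllPairs as AllPairs using (AllPairs; []; _∷_)
import Data.List.Relation.Unary.AllPairs.Properties as AllPairsP
open import Data.List.Relation.Unary.Linked using (Linked; []; [-]; _∷_)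
open import Data.List.Relation.Unary.Linked.Properties using (AllPairs⇒Linked; Linked⇒AllPairs)
open import Data.List.Relation.Unary.Unique.Propositional using (Unique)
import Data.List.Relation.Unary.Unique.Propositional.Properties as UniqueP
open import Data.List.Relation.Binary.Permutation.Propositional using (↭-sym; ↭⇒↭ₛ)
open import Data.List.Relation.Binary.Permutation.Propositional.Properties using (∈-resp-↭; ↭-length)
import Data.List.Relation.Binary.Permutation.Setoid.Properties as PermutationₛP
open import Data.List.Sort ≤-decTotalOrder using (sort; sort-↭; sort-↗)
open import Data.Product using (Σ; _×_; _,_; proj₁; proj₂; ∃; map₁; map₂)
open import Data.Sum using (_⊎_; inj₁; inj₂)
open import Data.Empty using (⊥; ⊥-elim)
open import Relation.Nullary using (yes; no)
open import Function.Bundles using (_⇔_; mk⇔)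
open import Function.Construct.Symmetry using (⇔-sym)
open import Function.Construct.Composition using (_⇔-∘_)
open import Function using (_∘′_)
open import Relation.Binary.PropositionalEquality

Increasing : List ℕ → Set
Increasing = AllPairs _<_

<-∉ : ∀ {x xs} → All (x <_) xs → x ∉ xs
<-∉ x<xs x∈xs = <-irrefl refl (All.lookup x<xs x∈xs)

increasing-sort : ∀ xs → Unique xs → Increasing (sort xs)
increasing-sort xs u = strict (Linked⇒AllPairs ≤-trans (sort-↗ xs)) (unique-sort u)
  where
  unique-sort : Unique xs → Unique (sort xs)
  unique-sort = PermutationₛP.Unique-resp-↭ (setoid ℕ) (↭⇒↭ₛ (↭-sym (sort-↭ xs)))
  strict : ∀ {ys} → AllPairs _≤_ ys → Unique ys → Increasing ys
  strict [] [] = []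
  strict (≤s ∷ ≤ss) (≢s ∷ ≢ss) = All.zipWith (λ (le , ne) → ≤∧≢⇒< le ne) (≤s , ≢s) ∷ strict ≤ss ≢ss

unique-++⁻ʳ : ∀ (xs : List ℕ) {ys} → Unique (xs ++ ys) → Unique ys
unique-++⁻ʳ []       u       = u
unique-++⁻ʳ (_ ∷ xs) (_ ∷ u) = unique-++⁻ʳ xs u

unique-++-disjoint : ∀ (xs : List ℕ) {ys z} → Unique (xs ++ ys) → z ∈ xs → z ∈ ys → ⊥
unique-++-disjoint (x ∷ xs) (x∉ ∷ _) (here refl) z∈ys = All.lookup x∉ (∈-++⁺ʳ xs z∈ys) refl
unique-++-disjoint (x ∷ xs) (_ ∷ u)  (there z∈) z∈ys  = unique-++-disjoint xs u z∈ z∈ys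

[k+m]Ck*k!*m!≡[k+m]! : ∀ k m → ((k + m) C k) * (k ! * m !) ≡ (k + m) !
[k+m]Ck*k!*m!≡[k+m]! k m = begin
  ((k + m) C k) * (k ! * m !)                    ≡⟨ cong (λ j → ((k + m) C k) * (k ! * j !)) (sym (m+n∸m≡n k m)) ⟩
  ((k + m) C k) * (k ! * (n ∸ k) !)              ≡⟨ cong (_* (k ! * (n ∸ k) !)) (nCk≡n!/k![n-k]! k≤n) ⟩
  (n ! / (k ! * (n ∸ k) !)) * (k ! * (n ∸ k) !)  ≡⟨ m/n*n≡m (k![n∸k]!∣n! k≤n) ⟩
  n !                                            ∎
  where
  open ≡-Reasoning
  n : ℕ
  n = k + m
  k≤n : k ≤ n
  k≤n = m≤m+n k m
  instance _ = k !* (n ∸ k) !≢0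

splits : ∀ {A : Set} → ℕ → List A → List (List A × List A)
splits zero    xs       = ([] , xs) ∷ []
splits (suc k) []       = []
splits (suc k) (x ∷ xs) = map (map₁ (x ∷_)) (splits k xs) ++ map (map₂ (x ∷_)) (splits (suc k) xs)

length-splits : ∀ {A : Set} k (xs : List A) → length (splits k xs) ≡ length xs C k
length-splits zero    xs       = refl
length-splits (suc k) []       = refl
length-splits (suc k) (x ∷ xs) = begin
  length (map (map₁ (x ∷_)) (splits k xs) ++ map (map₂ (x ∷_)) (splits (suc k) xs))
    ≡⟨ length-++ (map (map₁ (x ∷_)) (splits k xs)) ⟩
  length (map (map₁ (x ∷_)) (splits k xs)) + length (map (map₂ (x ∷_)) (splits (suc k) xs))
    ≡⟨ cong₂ _+_ (length-map _ (splits k xs)) (length-map _ (splits (suc k) xs)) ⟩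
  length (splits k xs) + length (splits (suc k) xs)
    ≡⟨ cong₂ _+_ (length-splits k xs) (length-splits (suc k) xs) ⟩
  length xs C k + length xs C suc k
    ≡⟨ nCk+nC[k+1]≡[n+1]C[k+1] (length xs) k ⟩
  suc (length xs) C suc k ∎
  where open ≡-Reasoning

∈-splits⁻ : ∀ {A : Set} {k} {x : A} {xs p} → p ∈ splits (suc k) (x ∷ xs) →
  (∃ λ q → q ∈ splits k xs × p ≡ map₁ (x ∷_) q) ⊎ (∃ λ q → q ∈ splits (suc k) xs × p ≡ map₂ (x ∷_) q)
∈-splits⁻ {k = k} {x} {xs} p∈ with ∈-++⁻ (map (map₁ (x ∷_)) (splits k xs)) p∈
... | inj₁ p∈ˡ = inj₁ (∈-map⁻ (map₁ (x ∷_)) p∈ˡ)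
... | inj₂ p∈ʳ = inj₂ (∈-map⁻ (map₂ (x ∷_)) p∈ʳ)

splits-lengths : ∀ {A : Set} k (xs : List A) {c r} → (c , r) ∈ splits k xs →
  length c ≡ k × length r + k ≡ length xs
splits-lengths zero    xs       (here refl) = refl , +-identityʳ (length xs)
splits-lengths (suc k) (x ∷ xs) p∈ with ∈-splits⁻ {k = k} {x} {xs} p∈
... | inj₁ (_ , q∈ , refl) with splits-lengths k xs q∈
...   | lc , lr = cong suc lc , trans (+-suc _ k) (cong suc lr)
splits-lengths (suc k) (x ∷ xs) p∈ | inj₂ (_ , q∈ , refl) with splits-lengths (suc k) xs q∈
...   | lc , lr = lc , cong suc lr

record IncreasingPartition (xs c r : List ℕ) : Set where
  field
    left⊆     : ∀ {z} → z ∈ c → z ∈ xs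
    right⊆    : ∀ {z} → z ∈ r → z ∈ xs
    covers    : ∀ {z} → z ∈ xs → z ∈ c ⊎ z ∈ r
    disjoint  : ∀ {z} → z ∈ c → z ∈ r → ⊥
    left-inc  : Increasing c
    right-inc : Increasing r
open IncreasingPartition

partition-[] : ∀ {xs} → Increasing xs → IncreasingPartition xs [] xs
partition-[] inc = record
  { left⊆ = λ () ; right⊆ = λ z∈ → z∈ ; covers = inj₂ ; disjoint = λ ()
  ; left-inc = [] ; right-inc = inc }

partition-consˡ : ∀ {x xs c r} → All (x <_) xs → IncreasingPartition xs c r →
  IncreasingPartition (x ∷ xs) (x ∷ c) r
partition-consˡ {x} x<xs P = record
  { left⊆ = λ { (here e) → here e ; (there z∈) → there (left⊆ P z∈) }
  ; right⊆ = λ z∈ → there (right⊆ P z∈)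
  ; covers = λ { (here e) → inj₁ (here e) ; (there z∈) → Data.Sum.map there (λ z∈r → z∈r) (covers P z∈) }
  ; disjoint = λ { (here refl) x∈r → <-∉ x<xs (right⊆ P x∈r) ; (there z∈c) z∈r → disjoint P z∈c z∈r }
  ; left-inc = All.tabulate (λ z∈c → All.lookup x<xs (left⊆ P z∈c)) ∷ left-inc P
  ; right-inc = right-inc P }

partition-consʳ : ∀ {x xs c r} → All (x <_) xs → IncreasingPartition xs c r →
  IncreasingPartition (x ∷ xs) c (x ∷ r)
partition-consʳ {x} x<xs P = record
  { left⊆ = λ z∈ → there (left⊆ P z∈)
  ; right⊆ = λ { (here e) → here e ; (there z∈) → there (right⊆ P z∈) }
  ; covers = λ { (here e) → inj₂ (here e) ; (there z∈) → Data.Sum.map (λ z∈c → z∈c) there (covers P z∈) }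
  ; disjoint = λ { x∈c (here refl) → <-∉ x<xs (left⊆ P x∈c) ; z∈c (there z∈r) → disjoint P z∈c z∈r }
  ; left-inc = left-inc P
  ; right-inc = All.tabulate (λ z∈r → All.lookup x<xs (right⊆ P z∈r)) ∷ right-inc P }

splits-partition : ∀ k {xs c r} → Increasing xs → (c , r) ∈ splits k xs → IncreasingPartition xs c r
splits-partition zero    inc (here refl) = partition-[] inc
splits-partition (suc k) {x ∷ xs} (x<xs ∷ inc) p∈ with ∈-splits⁻ {k = k} {x} {xs} p∈
... | inj₁ (_ , q∈ , refl) = partition-consˡ x<xs (splits-partition k inc q∈)
... | inj₂ (_ , q∈ , refl) = partition-consʳ x<xs (splits-partition (suc k) inc q∈)

splits-complete : ∀ {xs c} → Increasing xs → Increasing c → (∀ {z} → z ∈ c → z ∈ xs) →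
  ∃ λ r → (c , r) ∈ splits (length c) xs
splits-complete {xs} {[]} _ _ _ = xs , here refl
splits-complete {[]} {y ∷ c} _ _ c⊆ with c⊆ (here refl)
... | ()
splits-complete {x ∷ xs} {y ∷ c} (x<xs ∷ inc) (y<c ∷ incc) c⊆ with y ≟ x
... | yes refl =
  let r , c∈ = splits-complete inc incc tail⊆
  in r , ∈-++⁺ˡ (∈-map⁺ (map₁ (x ∷_)) c∈)
  where
  tail⊆ : ∀ {z} → z ∈ c → z ∈ xs
  tail⊆ z∈ with c⊆ (there z∈)
  ... | here refl = ⊥-elim (<-∉ y<c z∈)
  ... | there z∈xs = z∈xs
... | no y≢x =
  let r , c∈ = splits-complete inc (y<c ∷ incc) yc⊆
  in x ∷ r , ∈-++⁺ʳ (map (map₁ (x ∷_)) (splits (length c) xs)) (∈-map⁺ (map₂ (x ∷_)) c∈)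
  where
  y∈xs : y ∈ xs
  y∈xs with c⊆ (here refl)
  ... | here e = ⊥-elim (y≢x e)
  ... | there y∈ = y∈
  yc⊆ : ∀ {z} → z ∈ y ∷ c → z ∈ xs
  yc⊆ (here refl) = y∈xs
  yc⊆ (there z∈) with c⊆ (there z∈)
  ... | here refl = ⊥-elim (<-asym (All.lookup y<c z∈) (All.lookup x<xs y∈xs))
  ... | there z∈xs = z∈xs

splits-left-distinct : ∀ k {xs} → Increasing xs → AllPairs (λ p q → proj₁ p ≢ proj₁ q) (splits k xs)
splits-left-distinct zero _ = [] ∷ []
splits-left-distinct (suc k) {[]} _ = []
splits-left-distinct (suc k) {x ∷ xs} (x<xs ∷ inc) =
  AllPairsP.++⁺ (AllPairsP.map⁺ (AllPairs.map (λ ne e → ne (∷-injectiveʳ e)) (splits-left-distinct k inc)))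
                (AllPairsP.map⁺ (splits-left-distinct (suc k) inc))
                (AllP.map⁺ (All.tabulate λ _ → AllP.map⁺ (All.tabulate λ q∈ e →
                   <-∉ x<xs (left⊆ (splits-partition (suc k) inc q∈) (subst (x ∈_) e (here refl))))))

withFirstColumn : ℕ → (List ℕ → List Filling) → List ℕ × List ℕ → List Filling
withFirstColumn x fill (c , r) = map ((x ∷ c) ∷_) (fill r)

fillings : List ℕ → List ℕ → List Filling
fillings []           []       = [] ∷ []
fillings []           (_ ∷ _)  = []
fillings (zero ∷ _)   _        = []
fillings (suc l ∷ ls) []       = []
fillings (suc l ∷ ls) (x ∷ xs) = concatMap (withFirstColumn x (fillings ls)) (splits l xs)

count : List ℕ → ℕ → ℕ
count []           zero    = 1
count []           (suc _) = 0
count (zero ∷ _)   _       = 0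
count (suc l ∷ ls) zero    = 0
count (suc l ∷ ls) (suc n) = (n C l) * count ls (n ∸ l)

length-concatMap-const : ∀ {A B : Set} (f : A → List B) (xs : List A) {k} →
  (∀ {x} → x ∈ xs → length (f x) ≡ k) → length (concatMap f xs) ≡ length xs * k
length-concatMap-const f []       _   = refl
length-concatMap-const f (x ∷ xs) len =
  trans (length-++ (f x)) (cong₂ _+_ (len (here refl)) (length-concatMap-const f xs (len ∘′ there)))

length-fillings : ∀ ls S → length (fillings ls S) ≡ count ls (length S)
length-fillings []           []       = refl
length-fillings []           (_ ∷ _)  = refl
length-fillings (zero ∷ _)   _        = refl
length-fillings (suc l ∷ ls) []       = refl
length-fillings (suc l ∷ ls) (x ∷ xs) = begin
  length (concatMap (withFirstColumn x (fillings ls)) (splits l xs))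
    ≡⟨ length-concatMap-const (withFirstColumn x (fillings ls)) (splits l xs) length-branch ⟩
  length (splits l xs) * count ls (length xs ∸ l)
    ≡⟨ cong (_* count ls (length xs ∸ l)) (length-splits l xs) ⟩
  (length xs C l) * count ls (length xs ∸ l) ∎
  where
  open ≡-Reasoning
  length-branch : ∀ {p} → p ∈ splits l xs → length (withFirstColumn x (fillings ls) p) ≡ count ls (length xs ∸ l)
  length-branch {c , r} p∈ = begin
    length (map ((x ∷ c) ∷_) (fillings ls r)) ≡⟨ length-map _ (fillings ls r) ⟩
    length (fillings ls r)                    ≡⟨ length-fillings ls r ⟩
    count ls (length r)                       ≡⟨ cong (count ls) (sym (m+n∸n≡m (length r) l)) ⟩
    count ls (length r + l ∸ l)               ≡⟨ cong (λ n → count ls (n ∸ l)) (proj₂ (splits-lengths l xs p∈)) ⟩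
    count ls (length xs ∸ l)                  ∎

unique-concatMap : ∀ {A B K : Set} (key : A → K) (f : A → List B) {xs : List A} →
  AllPairs (λ p q → key p ≢ key q) xs → (∀ {p} → p ∈ xs → Unique (f p)) →
  (∀ {p q b} → b ∈ f p → b ∈ f q → key p ≡ key q) → Unique (concatMap f xs)
unique-concatMap key f {[]}     _             _     _   = []
unique-concatMap key f {p ∷ ps} (p≢ps ∷ keys) uf determines =
  UniqueP.++⁺ (uf (here refl)) (unique-concatMap key f keys (uf ∘′ there) determines) disjoint-fp
  where
  disjoint-fp : ∀ {b} → b ∈ f p × b ∈ concatMap f ps → ⊥
  disjoint-fp (b∈fp , b∈rest) with ∈-concat⁻′ (map f ps) b∈rest
  ... | _ , b∈fq , fq∈ with ∈-map⁻ f fq∈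
  ... | q , q∈ , refl = All.lookup p≢ps q∈ (determines b∈fp b∈fq)

fillings-unique : ∀ ls {S} → Increasing S → Unique (fillings ls S)
fillings-unique []           {[]}     _ = [] ∷ []
fillings-unique []           {_ ∷ _}  _ = []
fillings-unique (zero ∷ _)   _          = []
fillings-unique (suc l ∷ ls) {[]}     _ = []
fillings-unique (suc l ∷ ls) {x ∷ xs} (_ ∷ inc) =
  unique-concatMap proj₁ (withFirstColumn x (fillings ls)) (splits-left-distinct l inc)
    (λ {p} p∈ → UniqueP.map⁺ ∷-injectiveʳ (fillings-unique ls (right-inc (splits-partition l inc p∈))))
    first-column-determines
  where
  first-column-determines : ∀ {p q T} → T ∈ withFirstColumn x (fillings ls) p →
    T ∈ withFirstColumn x (fillings ls) q → proj₁ p ≡ proj₁ q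
  first-column-determines T∈p T∈q with ∈-map⁻ _ T∈p | ∈-map⁻ _ T∈q
  ... | _ , _ , refl | _ , _ , e = ∷-injectiveʳ (∷-injectiveˡ e)

record StandardFilling (S : List ℕ) (T : Filling) : Set where
  constructor standard
  field
    entries⊆       : ∀ {z} → z ∈ concat T → z ∈ S
    ⊆entries       : ∀ {z} → z ∈ S → z ∈ concat T
    entries-uniq   : Unique (concat T)
    columns-inc    : All (Linked _<_) T
    bottom-row-inc : Linked BottomLt T
open StandardFilling

bottoms-cons : ∀ {x c} T → (∀ T′ → T ≢ [] ∷ T′) → All (x <_) (concat T) →
  Linked BottomLt T → Linked BottomLt ((x ∷ c) ∷ T)
bottoms-cons []            _  _         _       = [-]
bottoms-cons ([] ∷ T′)     ne _         _       = ⊥-elim (ne T′ refl)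
bottoms-cons ((_ ∷ _) ∷ _) _  (x<y ∷ _) bottoms = x<y ∷ bottoms

standardFilling-cons : ∀ {x xs c r T} → All (x <_) xs → IncreasingPartition xs c r →
  StandardFilling r T → (∀ T′ → T ≢ [] ∷ T′) → StandardFilling (x ∷ xs) ((x ∷ c) ∷ T)
standardFilling-cons {x} {xs} {c} {r} {T} x<xs P F ne = standard
  (λ { (here e) → here e ; (there z∈) → there (rest⊆ z∈) })
  (λ { (here e) → here e ; (there z∈) → there (⊆rest z∈) })
  (All.tabulate (λ z∈ x≡z → <-irrefl x≡z (All.lookup x<xs (rest⊆ z∈)))
     ∷ UniqueP.++⁺ (AllPairs.map <⇒≢ (left-inc P)) (entries-uniq F)
         (λ (z∈c , z∈T) → disjoint P z∈c (entries⊆ F z∈T)))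
  (AllPairs⇒Linked (All.tabulate (λ z∈c → All.lookup x<xs (left⊆ P z∈c)) ∷ left-inc P) ∷ columns-inc F)
  (bottoms-cons T ne (All.tabulate (λ z∈T → All.lookup x<xs (right⊆ P (entries⊆ F z∈T)))) (bottom-row-inc F))
  where
  rest⊆ : ∀ {z} → z ∈ c ++ concat T → z ∈ xs
  rest⊆ z∈ with ∈-++⁻ c z∈
  ... | inj₁ z∈c = left⊆ P z∈c
  ... | inj₂ z∈T = right⊆ P (entries⊆ F z∈T)
  ⊆rest : ∀ {z} → z ∈ xs → z ∈ c ++ concat T
  ⊆rest z∈ with covers P z∈
  ... | inj₁ z∈c = ∈-++⁺ˡ z∈c
  ... | inj₂ z∈r = ∈-++⁺ʳ c (⊆entries F z∈r)

∈-fillings-cons⁻ : ∀ {l ls x xs T} → T ∈ fillings (suc l ∷ ls) (x ∷ xs) →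
  ∃ λ c → ∃ λ r → (c , r) ∈ splits l xs × ∃ λ T′ → T′ ∈ fillings ls r × T ≡ (x ∷ c) ∷ T′
∈-fillings-cons⁻ {l} {ls} {x} {xs} T∈ with ∈-concat⁻′ (map (withFirstColumn x (fillings ls)) (splits l xs)) T∈
... | _ , T∈branch , branch∈ with ∈-map⁻ (withFirstColumn x (fillings ls)) branch∈
... | (c , r) , p∈ , refl with ∈-map⁻ _ T∈branch
... | T′ , T′∈ , e = c , r , p∈ , T′ , T′∈ , e

fillings-first-column≢[] : ∀ ls S {T} → T ∈ fillings ls S → ∀ T′ → T ≢ [] ∷ T′
fillings-first-column≢[] []           []       (here refl) _ ()
fillings-first-column≢[] (suc l ∷ ls) (x ∷ xs) T∈          _ with ∈-fillings-cons⁻ {l} {ls} T∈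
... | _ , _ , _ , _ , _ , refl = λ ()

fillings-sound : ∀ ls S {T} → Increasing S → T ∈ fillings ls S → map length T ≡ ls × StandardFilling S T
fillings-sound []           []       _           (here refl) = refl , standard (λ ()) (λ ()) [] [] []
fillings-sound (suc l ∷ ls) (x ∷ xs) (x<xs ∷ inc) T∈ with ∈-fillings-cons⁻ {l} {ls} T∈
... | c , r , p∈ , T′ , T′∈ , refl =
  cong₂ _∷_ (cong suc (proj₁ (splits-lengths l xs p∈))) (proj₁ IH) ,
  standardFilling-cons x<xs P (proj₂ IH) (fillings-first-column≢[] ls r T′∈)
  where
  P : IncreasingPartition xs c r
  P = splits-partition l inc p∈
  IH : map length T′ ≡ ls × StandardFilling r T′
  IH = fillings-sound ls r (right-inc P) T′∈

bottom-left-least : ∀ y c T → All (Linked _<_) ((y ∷ c) ∷ T) → Linked BottomLt ((y ∷ c) ∷ T) →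
  ∀ {z} → z ∈ concat ((y ∷ c) ∷ T) → y ≤ z
bottom-left-least y c T cols bottoms (here refl) = ≤-refl
bottom-left-least y c T (col ∷ cols) bottoms (there z∈) with ∈-++⁻ c z∈
... | inj₁ z∈c with Linked⇒AllPairs <-trans col
...   | y<c ∷ _ = <⇒≤ (All.lookup y<c z∈c)
bottom-left-least y c [] _ _ (there z∈) | inj₂ ()
bottom-left-least y c ([] ∷ T) _ (() ∷ _) (there z∈) | inj₂ _
bottom-left-least y c ((y′ ∷ c′) ∷ T) (_ ∷ cols) (y<y′ ∷ bottoms) (there z∈) | inj₂ z∈T =
  ≤-trans (<⇒≤ y<y′) (bottom-left-least y′ c′ T cols bottoms z∈T)

bottom-left≡least : ∀ {x xs y c T} → Increasing (x ∷ xs) → StandardFilling (x ∷ xs) ((y ∷ c) ∷ T) → y ≡ x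
bottom-left≡least {x} {xs} {y} {c} {T} (x<xs ∷ _) F = ≤-antisym y≤x x≤y
  where
  y≤x : y ≤ x
  y≤x = bottom-left-least y c T (columns-inc F) (bottom-row-inc F) (⊆entries F (here refl))
  x≤y : x ≤ y
  x≤y with entries⊆ F (here refl)
  ... | here e = ≤-reflexive (sym e)
  ... | there y∈xs = <⇒≤ (All.lookup x<xs y∈xs)

standardFilling-tail : ∀ {x xs c r T} → Increasing (x ∷ xs) → StandardFilling (x ∷ xs) ((x ∷ c) ∷ T) →
  IncreasingPartition xs c r → StandardFilling r T
standardFilling-tail {x} {xs} {c} {r} {T} (x<xs ∷ _) F P = standard
  entries⊆r r⊆entries (unique-++⁻ʳ c rest-uniq)
  (All.tail (columns-inc F)) (Data.List.Relation.Unary.Linked.tail (bottom-row-inc F))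
  where
  rest-uniq : Unique (c ++ concat T)
  rest-uniq = AllPairs.tail (entries-uniq F)
  entries⊆r : ∀ {z} → z ∈ concat T → z ∈ r
  entries⊆r z∈T with entries⊆ F (there (∈-++⁺ʳ c z∈T))
  ... | here refl = ⊥-elim (All.lookup (AllPairs.head (entries-uniq F)) (∈-++⁺ʳ c z∈T) refl)
  ... | there z∈xs with covers P z∈xs
  ...   | inj₁ z∈c = ⊥-elim (unique-++-disjoint c rest-uniq z∈c z∈T)
  ...   | inj₂ z∈r = z∈r
  r⊆entries : ∀ {z} → z ∈ r → z ∈ concat T
  r⊆entries z∈r with ⊆entries F (there (right⊆ P z∈r))
  ... | here refl = ⊥-elim (<-∉ x<xs (right⊆ P z∈r))
  ... | there z∈rest with ∈-++⁻ c z∈rest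
  ...   | inj₁ z∈c = ⊥-elim (disjoint P z∈c z∈r)
  ...   | inj₂ z∈T = z∈T

fillings-complete : ∀ {S} T → Increasing S → All (0 <_) (map length T) → StandardFilling S T →
  T ∈ fillings (map length T) S
fillings-complete {[]}     []              _   _         _ = here refl
fillings-complete {_ ∷ _}  []              _   _         F with ⊆entries F (here refl)
... | ()
fillings-complete          ([] ∷ _)        _   (() ∷ _)  _
fillings-complete {[]}     ((_ ∷ _) ∷ _)   _   _         F with entries⊆ F (here refl)
... | ()
fillings-complete {x ∷ xs} ((y ∷ c) ∷ T)   inc (_ ∷ pos) F with bottom-left≡least inc F
... | refl = ∈-concat⁺′ (∈-map⁺ ((x ∷ c) ∷_) T∈) (∈-map⁺ (withFirstColumn x (fillings (map length T))) (proj₂ split))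
  where
  c⊆xs : ∀ {z} → z ∈ c → z ∈ xs
  c⊆xs z∈c with entries⊆ F (there (∈-++⁺ˡ z∈c))
  ... | here refl = ⊥-elim (All.lookup (AllPairs.head (entries-uniq F)) (∈-++⁺ˡ z∈c) refl)
  ... | there z∈xs = z∈xs
  inc-c : Increasing c
  inc-c = AllPairs.tail (Linked⇒AllPairs <-trans (All.head (columns-inc F)))
  split : ∃ λ r → (c , r) ∈ splits (length c) xs
  split = splits-complete (AllPairs.tail inc) inc-c c⊆xs
  P : IncreasingPartition xs c (proj₁ split)
  P = splits-partition (length c) (AllPairs.tail inc) (proj₂ split)
  T∈ : T ∈ fillings (map length T) (proj₁ split)
  T∈ = fillings-complete T (right-inc P) pos (standardFilling-tail inc F P)

occurrences-∉ : ∀ {b xs} → b ∉ xs → occurrences b xs ≡ 0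
occurrences-∉ b∉ = cong length (filter-none (_ ≟_) (¬Any⇒All¬ _ b∉))

∈⇒occurrences-pos : ∀ {b xs} → b ∈ xs → 0 < occurrences b xs
∈⇒occurrences-pos {b} = filter-some (b ≟_)

occurrences-pos⇒∈ : ∀ {b} xs → 0 < occurrences b xs → b ∈ xs
occurrences-pos⇒∈ {b} xs pos with filter (b ≟_) xs in eq
... | y ∷ _ with ∈-filter⁻ (b ≟_) {xs = xs} (subst (y ∈_) (sym eq) (here refl))
...   | y∈xs , refl = y∈xs

occurrences-unique : ∀ {b xs} → Unique xs → b ∈ xs → occurrences b xs ≡ 1
occurrences-unique {b} {x ∷ xs} (x∉ ∷ _) (here refl) rewrite filter-accept (b ≟_) {b} {xs} refl =
  cong suc (occurrences-∉ (λ b∈ → All.lookup x∉ b∈ refl))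
occurrences-unique {b} {x ∷ xs} (x∉ ∷ u) (there b∈) with b ≟ x
... | yes refl = ⊥-elim (All.lookup x∉ b∈ refl)
... | no b≢x rewrite filter-reject (b ≟_) {x} {xs} b≢x = occurrences-unique u b∈

unique-occurrences : ∀ xs → (∀ {b} → b ∈ xs → occurrences b xs ≡ 1) → Unique xs
unique-occurrences []       _    = []
unique-occurrences (x ∷ xs) once = All.tabulate (λ x′∈ x≡x′ → x∉xs (subst (_∈ xs) (sym x≡x′) x′∈))
                                   ∷ unique-occurrences xs once-xs
  where
  x∉xs : x ∉ xs
  x∉xs x∈ with once (here refl)
  ... | e rewrite filter-accept (x ≟_) {x} {xs} refl = <-irrefl (sym (suc-injective e)) (∈⇒occurrences-pos x∈)
  once-xs : ∀ {b} → b ∈ xs → occurrences b xs ≡ 1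
  once-xs {b} b∈ with b ≟ x | once (there b∈)
  ... | yes refl | _ = ⊥-elim (x∉xs b∈)
  ... | no b≢x   | e rewrite filter-reject (b ≟_) {x} {xs} b≢x = e

IsPSTab⇔StandardFilling : ∀ {B S ls T} → (∀ {z} → z ∈ B → z ∈ S) → (∀ {z} → z ∈ S → z ∈ B) →
  IsPSTab B ls T ⇔ (map length T ≡ ls × StandardFilling S T)
IsPSTab⇔StandardFilling {T = T} B⊆S S⊆B = mk⇔
  (λ (shape , ⊆B , once , cols , bottoms) → shape ,
     standard (λ z∈ → B⊆S (⊆B _ z∈))
              (λ z∈ → occurrences-pos⇒∈ (concat T) (≤-reflexive (sym (once _ (S⊆B z∈)))))
              (unique-occurrences (concat T) (λ z∈ → once _ (⊆B _ z∈))) cols bottoms)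
  (λ (shape , F) → shape , (λ _ z∈ → S⊆B (entries⊆ F z∈))
     , (λ _ z∈ → occurrences-unique (entries-uniq F) (⊆entries F (B⊆S z∈)))
     , columns-inc F , bottom-row-inc F)

count-formula : ∀ ls → All (0 <_) ls → ls ≢ [] →
  count ls (sum ls) * (prodPartial (sum ls) ls * prodFact ls) ≡ (sum ls ∸ 1) !
count-formula []                    _              ls≢[] = ⊥-elim (ls≢[] refl)
count-formula (zero ∷ _)            (() ∷ _)       _
count-formula (suc l ∷ [])          _              _     = begin
  ((l + 0) C l) * count [] (l + 0 ∸ l) * (1 * (l ! * 1))  ≡⟨ cong (λ n → (n C l) * count [] (n ∸ l) * (1 * (l ! * 1))) (+-identityʳ l) ⟩
  (l C l) * count [] (l ∸ l) * (1 * (l ! * 1))            ≡⟨ cong₂ (λ a b → a * count [] b * (1 * (l ! * 1))) (nCn≡1 l) (n∸n≡0 l) ⟩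
  1 * 1 * (1 * (l ! * 1))                                 ≡⟨ trans (*-identityˡ _) (trans (*-identityˡ _) (*-identityʳ _)) ⟩
  l !                                                     ≡⟨ cong _! (sym (+-identityʳ l)) ⟩
  (l + 0) !                                               ∎
  where open ≡-Reasoning
count-formula (suc l ∷ zero ∷ _)    (_ ∷ () ∷ _)   _
count-formula (suc l ∷ suc l′ ∷ ls) (_ ∷ pos)      _     = begin
  ((l + suc m) C l) * count tail (l + suc m ∸ l) * ((l + suc m ∸ l) * prodPartial (l + suc m ∸ l) tail * (l ! * F))
    ≡⟨ cong (λ j → ((l + suc m) C l) * count tail j * ((j * prodPartial j tail) * (l ! * F))) (m+n∸m≡n l (suc m)) ⟩
  ((l + suc m) C l) * K * ((suc m * P) * (l ! * F)) ≡⟨ regroup ((l + suc m) C l) K (suc m) P (l !) F ⟩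
  ((l + suc m) C l) * (l ! * (suc m * (K * (P * F)))) ≡⟨ cong (λ j → ((l + suc m) C l) * (l ! * (suc m * j))) IH ⟩
  ((l + suc m) C l) * (l ! * (suc m) !)              ≡⟨ [k+m]Ck*k!*m!≡[k+m]! l (suc m) ⟩
  (l + suc m) !                                      ∎
  where
  open ≡-Reasoning
  m : ℕ
  m = l′ + sum ls
  tail : List ℕ
  tail = suc l′ ∷ ls
  K P F : ℕ
  K = count tail (suc m)
  P = prodPartial (suc m) tail
  F = prodFact tail
  IH : K * (P * F) ≡ m !
  IH = count-formula tail pos (λ ())
  regroup : ∀ a b c d e f → (a * b) * ((c * d) * (e * f)) ≡ a * (e * (c * (b * (d * f))))
  regroup = solve-∀

composition-nonempty : ∀ {A : Set} (B : List A) {λs} → B ≢ [] → sum λs ≡ length B → λs ≢ []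
composition-nonempty []      B≢[] _  _    = B≢[] refl
composition-nonempty (_ ∷ _) _    () refl

∈fillings⇔StandardFilling : ∀ {S ls T} → Increasing S → All (0 <_) ls →
  T ∈ fillings ls S ⇔ (map length T ≡ ls × StandardFilling S T)
∈fillings⇔StandardFilling {S} {ls} {T} inc pos = mk⇔
  (fillings-sound ls S inc)
  (λ { (refl , F) → fillings-complete T inc pos F })

corollary5p3 : (B : List ℕ) → Unique B → All (0 <_) B → B ≢ [] →
               (λs : List ℕ) → IsComposition (length B) λs →
               Σ (List Filling) (λ L →
                 Unique L × (∀ T → (T ∈ L) ⇔ IsPSTab B λs T)
                 × length L * (prodPartial (length B) λs * prodFact λs)
                   ≡ (length B ∸ 1) !)
corollary5p3 B uniqB _ B≢[] λs (posλ , sumλ≡) =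
  fillings λs S , fillings-unique λs incS ,
  (λ T → ⇔-sym (IsPSTab⇔StandardFilling B⊆S S⊆B) ⇔-∘ ∈fillings⇔StandardFilling incS posλ) ,
  subst (λ n → length (fillings λs S) * (prodPartial n λs * prodFact λs) ≡ (n ∸ 1) !) sumλ≡ counted
  where
  S : List ℕ
  S = sort B
  incS : Increasing S
  incS = increasing-sort B uniqB
  B⊆S : ∀ {z} → z ∈ B → z ∈ S
  B⊆S = ∈-resp-↭ (↭-sym (sort-↭ B))
  S⊆B : ∀ {z} → z ∈ S → z ∈ B
  S⊆B = ∈-resp-↭ (sort-↭ B)
  Q : ℕ
  Q = prodPartial (sum λs) λs * prodFact λs
  counted : length (fillings λs S) * Q ≡ (sum λs ∸ 1) !
  counted = begin
    length (fillings λs S) * Q  ≡⟨ cong (_* Q) (length-fillings λs S) ⟩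
    count λs (length S) * Q     ≡⟨ cong (λ n → count λs n * Q) (trans (↭-length (sort-↭ B)) (sym sumλ≡)) ⟩
    count λs (sum λs) * Q       ≡⟨ count-formula λs posλ (composition-nonempty B B≢[] sumλ≡) ⟩
    (sum λs ∸ 1) !              ∎
    where open ≡-Reasoning
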